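{- Let $\mathcal M_{\mathcal I}$ be a system and let $R_{\mathcal H}$ be an indefinitely large $(n+1)$-ary relation on it. Then $\ll_R$ is an indefinitely large $\ll$-relation.
   Context: $\mathcal I$: non-empty set with directed preorder $\le$; $\uparrow i=\{i'\ge i\}$. Contexts $C=(i_0,\dots,i_{n-1})\in\mathcal I^n$, $()$ empty, $Ci$ extension. $\mathfrak D_n\subseteq\mathcal P(\mathcal I^n)$: $\mathcal H\in\mathfrak D_0$ iff $\mathcal H=\{()\}$; $\mathcal H\in\mathfrak D_1$ iff $\uparrow i\subseteq\mathcal H$ for some $i$; for $\mathcal H\subseteq\mathcal I^{n+1}$, $\mathcal H\in\mathfrak D_{n+1}$ iff $\{C\in\mathcal I^n:\{i:Ci\in\mathcal H\}\in\mathfrak D_1\}\in\mathfrak D_n$. System $\mathcal M_{\mathcal I}=(\mathcal M_i)_{i\in\mathcal I}$: finite sets, $\mathcal M_i\subseteq\mathcal M_{i'}$ for $i\le i'$, at least one non-empty; $\mathcal M_C=\mathcal M_{i_0}\times\dots\times\mathcal M_{i_{n-1}}$. An $(n+1)$-ary relation: family $(R_C)_{C\in\mathcal H}$, $\emptyset\ne\mathcal H\subseteq\mathcal I^{n+1}$, $R_C\subseteq\mathcal M_C$, compatible ($R_C(\vec a)\iff R_{C'}(\vec a)$ for $\vec a\in\mathcal M_C\cap\mathcal M_{C'}$); it is indefinitely large iff $\mathcal H\in\mathfrak D_{n+1}$. For $C\in\mathcal I^n$ and $\vec a\in\mathcal M_C$ let $\mathcal I_{R,\vec a:C}=\{i\in\mathcal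 I: Ci\in\mathcal H\text{ and }\exists b\in\mathcal M_i\,R_{Ci}(\vec ab)\}$ if this set is non-empty, and $\mathcal I_{R,\vec a:C}=\mathcal I$ otherwise. Define $(\ll_R)_{n+1}\subseteq\mathcal I^{n+1}$ by $Ci\in(\ll_R)_{n+1}$ iff $i\in\bigcap_{\vec a\in\mathcal M_C}\mathcal I_{R,\vec a:C}$, and let $\ll_R$ be the family generated by $(\ll_R)_{n+1}$: for $m<n+1$, $(i_0,\dots,i_{m-1})\in(\ll_R)_m$ iff it extends to an element of $(\ll_R)_{n+1}$; for $m>n+1$, $(\ll_R)_m=(\ll_R)_{n+1}\times\mathcal I^{m-n-1}$. A $\ll$-relation is a family $(\ll_m)_m$, $\ll_m\subseteq\mathcal I^m$, with $Ci\in\ll_{m+1}\Rightarrow C\in\ll_m$; it is indefinitely large iff $\ll_m\in\mathfrak D_m$ for all $m$. -}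

module Defs where

open import Data.Nat using (ℕ; zero; suc; _≤_; _<_)
open import Data.Vec using (Vec; []; _∷_; _∷ʳ_; init; last)
open import Data.List using (List)
open import Data.List.Membership.Propositional using (_∈_)
open import Data.Product using (Σ; ∃; _×_; _,_)
open import Data.Sum using (_⊎_)
open import Data.Unit using (⊤)
open import Relation.Nullary using (¬_)
open import Function.Bundles using (_⇔_)

record DirectedPreorder (I : Set) : Set₁ where
  field
    _≼_      : I → I → Set
    ≼-refl   : ∀ {i} → i ≼ i
    ≼-trans  : ∀ {i j k} → i ≼ j → j ≼ k → i ≼ k
    directed : ∀ i j → ∃ λ k → (i ≼ k) × (j ≼ k)
    inhabitant : I

module _ {I : Set} (P : DirectedPreorder I) where
  open DirectedPreorder P

  ↑ : I → I → Set
  ↑ i i' = i ≼ i'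

  𝔇₁ : (I → Set) → Set
  𝔇₁ H = ∃ λ i → ∀ i' → ↑ i i' → H i'

  -- 𝔇ₙ ⊆ 𝒫(Iⁿ); subsets of Iⁿ are predicates on Vec I n; context extension Ci is C ∷ʳ i.
  -- 𝔇₀ : H = {()}, i.e. () ∈ H.
  𝔇 : (n : ℕ) → (Vec I n → Set) → Set
  𝔇 zero    H = H []
  𝔇 (suc n) H = 𝔇 n (λ C → 𝔇₁ (λ i → H (C ∷ʳ i)))

  -- A system M_I of finite sets M_i ⊆ A (a common ambient set), increasing along ≼,
  -- with at least one non-empty M_i.  Finite = all elements occur in some list.
  record System : Set₁ where
    field
      A        : Set
      M        : I → A → Set
      finite   : ∀ i → ∃ λ (xs : List A) → ∀ a → M i a → a ∈ xs
      mono     : ∀ {i i'} → i ≼ i' → ∀ a → M i a → M i' a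
      nonempty : ∃ λ i → ∃ λ a → M i a

  module _ (S : System) where
    open System S

    MC : ∀ {n} → Vec I n → Vec A n → Set
    MC []      []       = ⊤
    MC (i ∷ C) (a ∷ as) = M i a × MC C as

    -- An (n+1)-ary relation R_H = (R_C)_{C ∈ H}.  R_C is given for every C but only
    -- its values for C ∈ H are used/constrained.
    record Relation (n : ℕ) : Set₁ where
      field
        H       : Vec I (suc n) → Set
        R       : Vec I (suc n) → Vec A (suc n) → Set
        H-ne    : ∃ λ C → H C
        R⊆M     : ∀ C → H C → ∀ as → R C as → MC C as
        compat  : ∀ C C' → H C → H C' → ∀ as → MC C as → MC C' as →
                  R C as ⇔ R C' as

    IndefinitelyLarge : ∀ {n} → Relation n → Set
    IndefinitelyLarge {n} Rel = 𝔇 (suc n) (Relation.H Rel)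

    module _ {n : ℕ} (Rel : Relation n) where
      open Relation Rel

      Wit : Vec I n → Vec A n → I → Set
      Wit C as i = H (C ∷ʳ i) × ∃ λ b → M i b × R (C ∷ʳ i) (as ∷ʳ b)

      -- I_{R, a:C}: the set above if non-empty, I otherwise.
      I[_∶_] : Vec A n → Vec I n → I → Set
      I[ as ∶ C ] i = Wit C as i ⊎ ¬ (∃ λ j → Wit C as j)

      ≪top : Vec I (suc n) → Set
      ≪top X = ∀ as → MC (init X) as → I[ as ∶ init X ] (last X)

  data Prefix : ∀ {m k} → Vec I m → Vec I k → Set where
    []  : ∀ {k} {D : Vec I k} → Prefix [] D
    _∷_ : ∀ x {m k} {C : Vec I m} {D : Vec I k} → Prefix C D → Prefix (x ∷ C) (x ∷ D)

  generated : ∀ {N} → (Vec I N → Set) → (m : ℕ) → Vec I m → Set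
  generated {N} L m C =
      (m ≤ N × ∃ λ (D : Vec I N) → L D × Prefix C D)
    ⊎ (N < m × ∃ λ (D : Vec I N) → L D × Prefix D C)

  Is≪Relation : ((m : ℕ) → Vec I m → Set) → Set
  Is≪Relation ≪ = ∀ m (C : Vec I m) i → ≪ (suc m) (C ∷ʳ i) → ≪ m C

  IndefinitelyLarge≪ : ((m : ℕ) → Vec I m → Set) → Set
  IndefinitelyLarge≪ ≪ = Is≪Relation ≪ × (∀ m → 𝔇 m (≪ m))

  ≪_ : {S : System} {n : ℕ} → Relation S n → (m : ℕ) → Vec I m → Set
  ≪_ {S} Rel = generated (≪top S Rel)

module Submission where

open import Defs
open import Data.Nat using (ℕ; zero; suc; _≤_; _≤‴_; ≤‴-reflexive; ≤‴-step; s≤s; _≤?_)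
open import Data.Nat.Properties using (≤-refl; ≤-trans; n≤1+n; m≤n⇒m<n∨m≡n; ≰⇒>; <⇒≤; ≤⇒≤‴)
open import Level using (0ℓ)
open import Axiom.ExcludedMiddle using (ExcludedMiddle)
open import Data.Vec using (Vec; []; _∷_; _∷ʳ_)
open import Data.Vec.Properties using (init-∷ʳ; last-∷ʳ)
open import Data.List using (List; []; _∷_; cartesianProductWith)
open import Data.List.Membership.Propositional using (_∈_)
open import Data.List.Membership.Propositional.Properties using (∈-cartesianProductWith⁺)
open import Data.List.Relation.Unary.Any using (here; there)
open import Data.Product using (∃; _×_; _,_)
open import Data.Sum using (inj₁; inj₂)
open import Data.Unit using (tt)
open import Relation.Nullary using (yes; no)
open import Relation.Binary.PropositionalEquality using (_≡_; refl)
open import Function.Bundles using (Equivalence)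

-- For a fixed context C, each tuple a⃗ ∈ M_C contributes the set I_{R,a⃗:C}, which
-- contains a final segment ↑ k of I: if some j has a witness b, then compatibility
-- of R and monotonicity of M carry that witness to every i above j at which Ci ∈ H;
-- otherwise I_{R,a⃗:C} = I (excluded middle decides which case holds).  Since M_C is
-- finite and I directed, the intersection over a⃗ ∈ M_C still contains a final
-- segment, so 𝔇 passes from H to (≪_R)_{n+1}.  The family generated by any L ∈ 𝔇_N
-- is then indefinitely large: below N because 𝔇 is preserved by taking initial
-- segments of contexts, above N because it is preserved by arbitrary extension.

module _ {I : Set} (P : DirectedPreorder I) where
  open DirectedPreorder P

  𝔇₁-mono : {X Y : I → Set} → (∀ i → X i → Y i) → 𝔇₁ P X → 𝔇₁ P Y
  𝔇₁-mono f (i , up) = i , λ i' i≼i' → f i' (up i' i≼i')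

  𝔇-mono : ∀ m {X Y : Vec I m → Set} → (∀ C → X C → Y C) → 𝔇 P m X → 𝔇 P m Y
  𝔇-mono zero    f d = f [] d
  𝔇-mono (suc m) f d = 𝔇-mono m (λ C → 𝔇₁-mono (λ i → f (C ∷ʳ i))) d

  ↑-𝔇₁ : ∀ j → 𝔇₁ P (↑ P j)
  ↑-𝔇₁ j = j , λ _ j≼i → j≼i

  𝔇₁-∩ : {X Y : I → Set} → 𝔇₁ P X → 𝔇₁ P Y → 𝔇₁ P (λ i → X i × Y i)
  𝔇₁-∩ (i , upX) (j , upY) with directed i j
  ... | k , i≼k , j≼k = k , λ l k≼l → upX l (≼-trans i≼k k≼l) , upY l (≼-trans j≼k k≼l)

  𝔇₁-⋂ : {B : Set} {X : B → I → Set} (xs : List B) →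
         (∀ x → x ∈ xs → 𝔇₁ P (X x)) → 𝔇₁ P (λ i → ∀ x → x ∈ xs → X x i)
  𝔇₁-⋂ []       _ = inhabitant , λ _ _ _ ()
  𝔇₁-⋂ {X = X} (x ∷ xs) d =
    𝔇₁-mono ∈-∷-elim (𝔇₁-∩ (d x (here refl)) (𝔇₁-⋂ xs (λ y y∈xs → d y (there y∈xs))))
    where
      ∈-∷-elim : ∀ i → X x i × (∀ y → y ∈ xs → X y i) → ∀ y → y ∈ x ∷ xs → X y i
      ∈-∷-elim i (Xx , Xxs) y (here refl)  = Xx
      ∈-∷-elim i (Xx , Xxs) y (there y∈xs) = Xxs y y∈xs

  𝔇-∷ʳ⁺ : ∀ m {X : Vec I m → Set} {Y : Vec I (suc m) → Set} →
           (∀ C i → X C → Y (C ∷ʳ i)) → 𝔇 P m X → 𝔇 P (suc m) Y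
  𝔇-∷ʳ⁺ m f = 𝔇-mono m (λ C XC → inhabitant , λ i _ → f C i XC)

  𝔇-∷ʳ⁻ : ∀ m {X : Vec I (suc m) → Set} {Y : Vec I m → Set} →
           (∀ C i → X (C ∷ʳ i) → Y C) → 𝔇 P (suc m) X → 𝔇 P m Y
  𝔇-∷ʳ⁻ m f = 𝔇-mono m (λ C (i , up) → f C i (up i ≼-refl))

  Is≪Relation⇒𝔇-downward : ∀ {≺ : (m : ℕ) → Vec I m → Set} {m N} →
                           Is≪Relation P ≺ → m ≤‴ N → 𝔇 P N (≺ N) → 𝔇 P m (≺ m)
  Is≪Relation⇒𝔇-downward         _   (≤‴-reflexive refl) d = d
  Is≪Relation⇒𝔇-downward {≺} {m} rel (≤‴-step m<N)       d =
    𝔇-∷ʳ⁻ m {X = ≺ (suc m)} (rel m) (Is≪Relation⇒𝔇-downward rel m<N d)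

  Prefix-refl : ∀ {m} (C : Vec I m) → Prefix P C C
  Prefix-refl []      = []
  Prefix-refl (x ∷ C) = x ∷ Prefix-refl C

  ∷ʳ-Prefix⁻ : ∀ {m k} (C : Vec I m) i {D : Vec I k} → Prefix P (C ∷ʳ i) D → Prefix P C D
  ∷ʳ-Prefix⁻ []      i _         = []
  ∷ʳ-Prefix⁻ (x ∷ C) i (.x ∷ p) = x ∷ ∷ʳ-Prefix⁻ C i p

  Prefix-∷ʳ⁺ : ∀ {m k} {D : Vec I k} (C : Vec I m) i → Prefix P D C → Prefix P D (C ∷ʳ i)
  Prefix-∷ʳ⁺ C       i []        = []
  Prefix-∷ʳ⁺ (x ∷ C) i (.x ∷ p) = x ∷ Prefix-∷ʳ⁺ C i p

  Prefix-∷ʳ⁻ : ∀ {m k} (D : Vec I k) (C : Vec I m) i → k ≤ m → Prefix P D (C ∷ʳ i) → Prefix P D C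
  Prefix-∷ʳ⁻ []      C        i _         _         = []
  Prefix-∷ʳ⁻ (x ∷ D) (.x ∷ C) i (s≤s k≤m) (.x ∷ p) = x ∷ Prefix-∷ʳ⁻ D C i k≤m p

  Prefix-sameLength⇒≡ : ∀ {m} {D C : Vec I m} → Prefix P D C → D ≡ C
  Prefix-sameLength⇒≡ {D = []}    {[]}     []        = refl
  Prefix-sameLength⇒≡ {D = x ∷ D} {.x ∷ C} (.x ∷ p) with Prefix-sameLength⇒≡ p
  ... | refl = refl

  module _ {N : ℕ} (L : Vec I N → Set) where

    ExtendedBy : ∀ {m} → Vec I m → Set
    ExtendedBy C = ∃ λ (D : Vec I N) → L D × Prefix P D C

    generated-is≪Relation : Is≪Relation P (generated P L)
    generated-is≪Relation m C i (inj₁ (1+m≤N , D , LD , Ci⊑D)) =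
      inj₁ (≤-trans (n≤1+n m) 1+m≤N , D , LD , ∷ʳ-Prefix⁻ C i Ci⊑D)
    generated-is≪Relation m C i (inj₂ (s≤s N≤m , D , LD , D⊑Ci)) with m≤n⇒m<n∨m≡n N≤m
    ... | inj₁ N<m  = inj₂ (N<m , D , LD , Prefix-∷ʳ⁻ D C i (<⇒≤ N<m) D⊑Ci)
    ... | inj₂ refl with Prefix-sameLength⇒≡ (Prefix-∷ʳ⁻ D C i ≤-refl D⊑Ci)
    ...   | refl = inj₁ (≤-refl , C , LD , Prefix-refl C)

    ExtendedBy-large : 𝔇 P N L → ∀ {m} → N ≤ m → 𝔇 P m ExtendedBy
    ExtendedBy-large dL {m} N≤m with m≤n⇒m<n∨m≡n N≤m
    ... | inj₂ refl = 𝔇-mono N (λ C LC → C , LC , Prefix-refl C) dL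
    ... | inj₁ (s≤s {n = m'} N≤m') =
      𝔇-∷ʳ⁺ m' {Y = ExtendedBy} (λ C i (D , LD , D⊑C) → D , LD , Prefix-∷ʳ⁺ C i D⊑C)
            (ExtendedBy-large dL N≤m')

    generated-large : 𝔇 P N L → ∀ m → 𝔇 P m (generated P L m)
    generated-large dL m with m ≤? N
    ... | yes m≤N = Is≪Relation⇒𝔇-downward generated-is≪Relation (≤⇒≤‴ m≤N)
                      (𝔇-mono N (λ C LC → inj₁ (≤-refl , C , LC , Prefix-refl C)) dL)
    ... | no m≰N  = 𝔇-mono m (λ C e → inj₂ (≰⇒> m≰N , e)) (ExtendedBy-large dL (<⇒≤ (≰⇒> m≰N)))

  module _ (S : System P) where
    open System S

    MC-∷ʳ : ∀ {m} (C : Vec I m) as i b → MC P S C as → M i b → MC P S (C ∷ʳ i) (as ∷ʳ b)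
    MC-∷ʳ []      []       i b _           Mb = Mb , tt
    MC-∷ʳ (j ∷ C) (a ∷ as) i b (Ma , MCas) Mb = Ma , MC-∷ʳ C as i b MCas Mb

    MC-∷ʳ⁻ : ∀ {m} (C : Vec I m) as i b → MC P S (C ∷ʳ i) (as ∷ʳ b) → MC P S C as
    MC-∷ʳ⁻ []      []       i b _           = tt
    MC-∷ʳ⁻ (j ∷ C) (a ∷ as) i b (Ma , MCas) = Ma , MC-∷ʳ⁻ C as i b MCas

    MC-finite : ∀ {m} (C : Vec I m) → ∃ λ (ass : List (Vec A m)) → ∀ as → MC P S C as → as ∈ ass
    MC-finite []      = [] ∷ [] , λ { [] _ → here refl }
    MC-finite (i ∷ C) with finite i | MC-finite C
    ... | xs , Mi⊆xs | ass , MC⊆ass =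
      cartesianProductWith _∷_ xs ass ,
      λ { (a ∷ as) (Ma , MCas) → ∈-cartesianProductWith⁺ _∷_ (Mi⊆xs a Ma) (MC⊆ass as MCas) }

    module _ {n : ℕ} (Rel : Relation P S n) where
      open Relation Rel

      Wit-mono : ∀ {C as j i} → Wit P S Rel C as j → j ≼ i → H (C ∷ʳ i) → Wit P S Rel C as i
      Wit-mono {C} {as} {j} {i} (HCj , b , Mjb , Rb) j≼i HCi =
        HCi , b , Mib , Equivalence.to (compat (C ∷ʳ j) (C ∷ʳ i) HCj HCi (as ∷ʳ b) MCjb MCib) Rb
        where
          Mib : M i b
          Mib = mono j≼i b Mjb
          MCjb : MC P S (C ∷ʳ j) (as ∷ʳ b)
          MCjb = R⊆M (C ∷ʳ j) HCj (as ∷ʳ b) Rb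
          MCib : MC P S (C ∷ʳ i) (as ∷ʳ b)
          MCib = MC-∷ʳ C as i b (MC-∷ʳ⁻ C as j b MCjb) Mib

      I[∶]-𝔇₁ : ExcludedMiddle 0ℓ → ∀ C as →
                𝔇₁ P (λ i → H (C ∷ʳ i)) → 𝔇₁ P (I[_∶_] P S Rel as C)
      I[∶]-𝔇₁ em C as dH with em {∃ λ j → Wit P S Rel C as j}
      ... | no ¬wit      = inhabitant , λ _ _ → inj₂ ¬wit
      ... | yes (j , wit) =
        𝔇₁-mono (λ i (j≼i , HCi) → inj₁ (Wit-mono wit j≼i HCi)) (𝔇₁-∩ (↑-𝔇₁ j) dH)

      ≪top-∷ʳ : ∀ C i → (∀ as → MC P S C as → I[_∶_] P S Rel as C i) → ≪top P S Rel (C ∷ʳ i)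
      ≪top-∷ʳ C i f rewrite init-∷ʳ i C | last-∷ʳ i C = f

      ≪top-𝔇₁ : ExcludedMiddle 0ℓ → ∀ C →
                𝔇₁ P (λ i → H (C ∷ʳ i)) → 𝔇₁ P (λ i → ≪top P S Rel (C ∷ʳ i))
      ≪top-𝔇₁ em C dH with MC-finite C
      ... | ass , MC⊆ass =
        𝔇₁-mono (λ i I∩ → ≪top-∷ʳ C i (λ as MCas → I∩ as (MC⊆ass as MCas)))
                (𝔇₁-⋂ ass (λ as _ → I[∶]-𝔇₁ em C as dH))

      ≪top-large : ExcludedMiddle 0ℓ → IndefinitelyLarge P S Rel → 𝔇 P (suc n) (≪top P S Rel)
      ≪top-large em = 𝔇-mono n (≪top-𝔇₁ em)

lemma4p6 : ExcludedMiddle 0ℓ →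
    {I : Set} (P : DirectedPreorder I) (S : System P) (n : ℕ) (R : Relation P S n) →
    IndefinitelyLarge P S R →
    IndefinitelyLarge≪ P (≪_ P R)
lemma4p6 em P S n R large =
  generated-is≪Relation P (≪top P S R) , generated-large P (≪top P S R) (≪top-large P S R em large)
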